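{- Let $\Gamma$ be a pasting context and let $\sigma$ be a substitution with $D^n\vdash\sigma:\Gamma$ valid (in $\mathrm{Catt}_{\mathrm{su}}$) such that $x[\sigma]$ is a variable for every variable $x$ of $\Gamma$. Then $\Gamma\equiv D^k$ for some $k\le n$, and $\sigma$ is a subdisc inclusion.
   Context: $\mathrm{Catt}_{\mathrm{su}}$ is a dependent type theory with types $\star$ and $s\to_A t$, terms that are variables or coherences $\mathsf{coh}(\Gamma:A)[\sigma]$, substitutions (lists of terms), the standard typing rules for contexts, types and substitutions ($\Gamma\vdash\langle\sigma,x\mapsto t\rangle:(\Delta,x:A)$ when $\Gamma\vdash\sigma:\Delta$, $\Delta\vdash A$ and $\Gamma\vdash t:A[\sigma]$, where $A[\sigma]$ is substitution application), a coherence rule, and a conversion rule along a definitional equality; $\equiv$ is syntactic equality up to $\alpha$-equivalence. Pasting contexts are those derivable by: $(x:\star)\vdash_p x:\star$; from $\Gamma\vdash_p x:A$ infer $\Gamma,y:A,f:x\to_A y\vdash_p f:x\to_A y$; from $\Gamma\vdash_p f:x\to_A y$ infer $\Gamma\vdash_p y:A$; and $\Gamma$ is a pasting context if $\Gamma\vdash_p x:\star$ for some $x$. Disc contexts: $D^0=(d_0:\star)$, $S^{ -1}=\star$, $D^{k+1}=D^k,(d_k':S^{k-1}),(d_{k+1}:S^k)$, $S^k=d_k\to_{S^{k-1}}d_k'$. Subdisc inclusions: $\mathrm{id}_{D^n}$ and, for $k<n$, the two substitutions $D^n\vdash\partial^-_{k,n}:D^k$ and $D^n\vdash\partial^+_{k,n}:D^k$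 which send every variable of $D^k$ to the variable of the same name, except that $\partial^+_{k,n}$ sends $d_k$ to $d_k'$ (i.e. the inclusions of $D^k$ as the $k$-dimensional source, resp. target, of $D^n$). -}

module Defs where

-- Syntax and typing of Catt_su, with de Bruijn LEVELS for variables
-- (so syntactic equality _≡_ is equality up to α-equivalence).

open import Data.Nat using (ℕ; zero; suc; _+_; _*_; _∸_; _⊔_; _<_; _≤_; _≡ᵇ_; _<ᵇ_)
open import Data.Bool using (Bool; true; false; if_then_else_; _∨_)
open import Data.List using (List; []; _∷_; _++_; [_])
open import Data.List.Membership.Propositional using (_∈_)
open import Data.List.Relation.Binary.Subset.Propositional using (_⊆_)
open import Data.Maybe using (Maybe; just; nothing)
open import Data.Product using (Σ; _×_; _,_; ∃)
open import Relation.Binary.PropositionalEquality using (_≡_)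
open import Relation.Nullary using (¬_)

infixl 5 _▸_ _,,_

mutual
  -- contexts are snoc lists of types; the variable at level i is the
  -- (i+1)-th entry from the left
  data Ctx : Set where
    ∅   : Ctx
    _▸_ : Ctx → Ty → Ctx

  data Ty : Set where
    ⋆   : Ty
    arr : Tm → Ty → Tm → Ty

  data Tm : Set where
    var : ℕ → Tm
    coh : Ctx → Ty → Sub → Tm

  data Sub : Set where
    ⟨⟩   : Sub
    _,,_ : Sub → Tm → Sub

lenCtx : Ctx → ℕ
lenCtx ∅ = 0
lenCtx (Γ ▸ _) = suc (lenCtx Γ)

lenSub : Sub → ℕ
lenSub ⟨⟩ = 0
lenSub (σ ,, _) = suc (lenSub σ)

lookupTy : Ctx → ℕ → Maybe Ty
lookupTy ∅ i = nothing
lookupTy (Γ ▸ A) i = if i ≡ᵇ lenCtx Γ then just A else lookupTy Γ i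

lookupSub : Sub → ℕ → Maybe Tm
lookupSub ⟨⟩ i = nothing
lookupSub (σ ,, t) i = if i ≡ᵇ lenSub σ then just t else lookupSub σ i

mutual
  _[_]tm : Tm → Sub → Tm
  var i [ σ ]tm with lookupSub σ i
  ... | just t  = t
  ... | nothing = var i
  coh Δ A τ [ σ ]tm = coh Δ A (τ ∘s σ)

  _[_]ty : Ty → Sub → Ty
  ⋆ [ σ ]ty = ⋆
  arr s A t [ σ ]ty = arr (s [ σ ]tm) (A [ σ ]ty) (t [ σ ]tm)

  _∘s_ : Sub → Sub → Sub
  ⟨⟩ ∘s σ = ⟨⟩
  (τ ,, t) ∘s σ = (τ ∘s σ) ,, (t [ σ ]tm)

mutual
  fvTm : Tm → List ℕ
  fvTm (var i) = [ i ]
  fvTm (coh Δ A σ) = fvSub σ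

  fvTy : Ty → List ℕ
  fvTy ⋆ = []
  fvTy (arr s A t) = fvTm s ++ fvTy A ++ fvTm t

  fvSub : Sub → List ℕ
  fvSub ⟨⟩ = []
  fvSub (σ ,, t) = fvSub σ ++ fvTm t

allVars : Ctx → List ℕ
allVars ∅ = []
allVars (Γ ▸ _) = allVars Γ ++ [ lenCtx Γ ]

_≈ˢ_ : List ℕ → List ℕ → Set
xs ≈ˢ ys = (xs ⊆ ys) × (ys ⊆ xs)

dim : Ty → ℕ
dim ⋆ = 0
dim (arr _ A _) = suc (dim A)

dimCtx : Ctx → ℕ
dimCtx ∅ = 0
dimCtx (Γ ▸ A) = dimCtx Γ ⊔ dim A

data _⊢p_∶_ : Ctx → ℕ → Ty → Set where
  pss : (∅ ▸ ⋆) ⊢p 0 ∶ ⋆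
  pse : ∀ {Γ x A} → Γ ⊢p x ∶ A →
        (Γ ▸ A ▸ arr (var x) A (var (lenCtx Γ))) ⊢p suc (lenCtx Γ) ∶ arr (var x) A (var (lenCtx Γ))
  psd : ∀ {Γ f x A y} → Γ ⊢p f ∶ arr (var x) A (var y) → Γ ⊢p y ∶ A

IsPasting : Ctx → Set
IsPasting Γ = ∃ λ x → Γ ⊢p x ∶ ⋆

-- Boundaries of pasting contexts (Finster–Mimram), as lists of variables.
-- bd ε i Γ : the variables of the i-dimensional source (ε = false) or
-- target (ε = true) boundary of Γ.

dropLast : List ℕ → List ℕ
dropLast [] = []
dropLast (x ∷ []) = []
dropLast (x ∷ y ∷ xs) = x ∷ dropLast (y ∷ xs)

bd : Bool → ℕ → Ctx → List ℕ
bd ε i ∅ = []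
bd ε i (∅ ▸ A) = [ 0 ]
bd ε i (Γ ▸ A ▸ B) =
  if dim A <ᵇ i then bd ε i Γ ++ (lenCtx Γ ∷ suc (lenCtx Γ) ∷ [])
  else if i <ᵇ dim A then bd ε i Γ
  else (if ε then dropLast (bd ε i Γ) ++ [ lenCtx Γ ] else bd ε i Γ)

-- source / target boundary ∂⁻Γ, ∂⁺Γ (of dimension dim Γ - 1; empty if dim Γ = 0)
bdry : Bool → Ctx → List ℕ
bdry ε Γ with dimCtx Γ
... | zero = []
... | suc i = bd ε i Γ

data Op (Δ : Ctx) : Ty → Set where
  comp  : ∀ s B t → IsPasting Δ →
          (fvTm s ++ fvTy B) ≈ˢ bdry false Δ →
          (fvTm t ++ fvTy B) ≈ˢ bdry true Δ → Op Δ (arr s B t)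
  equiv : ∀ s B t → IsPasting Δ →
          (fvTm s ++ fvTy B) ≈ˢ allVars Δ →
          (fvTm t ++ fvTy B) ≈ˢ allVars Δ → Op Δ (arr s B t)

-- Discs and spheres.
-- Levels: d_k is level 2k, d_k' is level 2k+1.
-- Sph k is S^(k-1) (so Sph 0 = S^(-1) = ⋆), the type of d_k in D^k.

Sph : ℕ → Ty
Sph zero = ⋆
Sph (suc k) = arr (var (2 * k)) (Sph k) (var (suc (2 * k)))

Disc : ℕ → Ctx
Disc zero = ∅ ▸ ⋆
Disc (suc k) = Disc k ▸ Sph k ▸ Sph (suc k)

-- {A , t} : the substitution out of D^(dim A)
discSub : Ty → Tm → Sub
discSub ⋆ t = ⟨⟩ ,, t
discSub (arr s A s') t = discSub A s ,, s' ,, t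

idTm : Ty → Tm → Tm
idTm A t = coh (Disc (dim A)) (arr (var (2 * dim A)) (Sph (dim A)) (var (2 * dim A))) (discSub A t)

mkSub : ℕ → (ℕ → Tm) → Sub
mkSub zero f = ⟨⟩
mkSub (suc m) f = mkSub m f ,, f m

-- π_x for x = f at level p+1 with f : z →_B y, y at level p;
-- m is the length of the context being pruned
πsub : ℕ → ℕ → ℕ → Ty → Sub
πsub m p z B = mkSub m λ j →
  if j <ᵇ p then var j
  else if j ≡ᵇ p then var z
  else if j ≡ᵇ suc p then idTm B (var z)
  else var (j ∸ 2)

pruneCtx : Sub → ℕ → Ctx → Ctx
pruneCtx π p ∅ = ∅
pruneCtx π p (Γ ▸ A) =
  if (lenCtx Γ ≡ᵇ p) ∨ (lenCtx Γ ≡ᵇ suc p) then pruneCtx π p Γ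
  else pruneCtx π p Γ ▸ (A [ π ]ty)

pruneSub : ℕ → Sub → Sub
pruneSub p ⟨⟩ = ⟨⟩
pruneSub p (σ ,, t) =
  if (lenSub σ ≡ᵇ p) ∨ (lenSub σ ≡ᵇ suc p) then pruneSub p σ
  else pruneSub p σ ,, t

LocMax : Ctx → ℕ → Set
LocMax Δ v = ∀ j A → lookupTy Δ j ≡ just A → ¬ (v ∈ fvTy A)

data Rule : Tm → Tm → Set where
  dr    : ∀ A t → Rule (coh (Disc (dim A)) (Sph (dim A)) (discSub A t)) t
  ecr   : ∀ Δ s A σ → Rule (coh Δ (arr s A s) σ) (idTm (A [ σ ]ty) (s [ σ ]tm))
  prune : ∀ Δ A σ p z B C u →
          lookupTy Δ (suc p) ≡ just (arr (var z) B (var p)) →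
          LocMax Δ (suc p) →
          lookupSub σ (suc p) ≡ just (idTm C u) →
          Rule (coh Δ A σ)
               (coh (pruneCtx (πsub (lenCtx Δ) p z B) p Δ)
                    (A [ πsub (lenCtx Δ) p z B ]ty)
                    (pruneSub p σ))

infix 4 _⊢ty_ _⊢_∶_ _⊢s_∶_ _⊢_＝_ _⊢_＝ty_ _⊢_＝s_

data _⊢ty_ : Ctx → Ty → Set
data _⊢_∶_ : Ctx → Tm → Ty → Set
data _⊢s_∶_ : Ctx → Sub → Ctx → Set
data _⊢_＝_ : Ctx → Tm → Tm → Set
data _⊢_＝ty_ : Ctx → Ty → Ty → Set
data _⊢_＝s_ : Ctx → Sub → Sub → Set

data _⊢ty_ where
  ⋆-ty   : ∀ {Γ} → Γ ⊢ty ⋆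
  arr-ty : ∀ {Γ A s t} → Γ ⊢ty A → Γ ⊢ s ∶ A → Γ ⊢ t ∶ A → Γ ⊢ty arr s A t

data _⊢_∶_ where
  var-tm  : ∀ {Γ i A} → lookupTy Γ i ≡ just A → Γ ⊢ var i ∶ A
  coh-tm  : ∀ {Γ Δ A σ} → Op Δ A → Δ ⊢ty A → Γ ⊢s σ ∶ Δ →
            Γ ⊢ coh Δ A σ ∶ (A [ σ ]ty)
  conv-tm : ∀ {Γ t A B} → Γ ⊢ t ∶ A → Γ ⊢ A ＝ty B → Γ ⊢ t ∶ B

data _⊢s_∶_ where
  ⟨⟩-sub  : ∀ {Γ} → Γ ⊢s ⟨⟩ ∶ ∅
  ext-sub : ∀ {Γ Δ σ A t} → Γ ⊢s σ ∶ Δ → Δ ⊢ty A → Γ ⊢ t ∶ (A [ σ ]ty) →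
            Γ ⊢s (σ ,, t) ∶ (Δ ▸ A)

data _⊢_＝_ where
  var-eq   : ∀ {Γ i A} → lookupTy Γ i ≡ just A → Γ ⊢ var i ＝ var i
  sym-eq   : ∀ {Γ s t} → Γ ⊢ s ＝ t → Γ ⊢ t ＝ s
  trans-eq : ∀ {Γ s t u} → Γ ⊢ s ＝ t → Γ ⊢ t ＝ u → Γ ⊢ s ＝ u
  coh-eq   : ∀ {Γ Δ A B σ τ} → Δ ⊢ A ＝ty B → Γ ⊢ σ ＝s τ →
             Γ ⊢ coh Δ A σ ＝ coh Δ B τ
  rule-eq  : ∀ {Γ s t A} → Rule s t → Γ ⊢ s ∶ A → Γ ⊢ s ＝ t

data _⊢_＝ty_ where
  ⋆-eq   : ∀ {Γ} → Γ ⊢ ⋆ ＝ty ⋆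
  arr-eq : ∀ {Γ s s' A A' t t'} → Γ ⊢ s ＝ s' → Γ ⊢ A ＝ty A' → Γ ⊢ t ＝ t' →
           Γ ⊢ arr s A t ＝ty arr s' A' t'

data _⊢_＝s_ where
  ⟨⟩-eq  : ∀ {Γ} → Γ ⊢ ⟨⟩ ＝s ⟨⟩
  ext-eq : ∀ {Γ σ τ s t} → Γ ⊢ σ ＝s τ → Γ ⊢ s ＝ t → Γ ⊢ (σ ,, s) ＝s (τ ,, t)

VarToVar : Sub → Ctx → Set
VarToVar σ Γ = ∀ i → i < lenCtx Γ → ∃ λ j → lookupSub σ i ≡ just (var j)

idSub : ℕ → Sub
idSub m = mkSub m var

data SubdiscIncl (n : ℕ) : ℕ → Sub → Set where
  id-incl  : SubdiscIncl n n (idSub (suc (2 * n)))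
  src-incl : ∀ {k} → k < n → SubdiscIncl n k (idSub (suc (2 * k)))
  tgt-incl : ∀ {k} → k < n → SubdiscIncl n k (idSub (2 * k) ,, var (suc (2 * k)))

module Submission where

-- A variable-to-variable substitution D^n ⊢ σ : Γ is a renaming f of the
-- variables of Γ into those of D^n.  The crux is that f preserves types on the
-- nose: if x : A in Γ, then f x : A[f] in D^n, although the typing of x[σ] may
-- use conversions.  This holds because the largest free variable of a term is
-- invariant under definitional equality in a context whose types only mention
-- earlier variables: disc removal, endo-coherence removal and pruning only drop
-- variables bounded by ones they keep.  Comparing largest variables componentwise
-- then identifies two types built from variables alone.
--
-- In D^n the variable at level j has type S^(⌊j/2⌋-1), whose source is even.  A
-- type-preserving renaming therefore forbids the pasting step that glues an arrow
-- to an odd variable d_j', so Γ is a disc D^k; the renaming fixes every variable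
-- below d_k and sends d_k to d_k or d_k', which is a subdisc inclusion.

open import Defs
open import Data.Nat using (ℕ; zero; suc; _≤_; _<_; _⊔_; _≡ᵇ_; _<ᵇ_; z≤n; s≤s; _*_; ⌊_/2⌋)
open import Data.Nat.Properties
open import Data.Bool using (true; false; T; _∨_)
open import Data.Unit using (⊤; tt)
open import Data.List using (List; []; _∷_; _++_; foldr)
open import Data.List.Membership.Propositional using (_∈_)
open import Data.List.Membership.Propositional.Properties using (∈-++⁺ˡ; ∈-++⁺ʳ; ∈-++⁻)
open import Data.List.Relation.Unary.All using (All; []; _∷_)
open import Data.List.Relation.Unary.All.Properties using (++⁺; ++⁻ˡ; ++⁻ʳ)
open import Data.List.Relation.Unary.Any using (here; there)
open import Data.Maybe using (just; nothing; fromMaybe)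
open import Data.Maybe.Properties using (just-injective)
open import Data.Product using (Σ; _×_; _,_; ∃; proj₁; proj₂)
open import Data.Sum using (_⊎_; inj₁; inj₂; [_,_])
open import Data.Empty using (⊥; ⊥-elim)
open import Relation.Binary.PropositionalEquality hiding ([_])
open import Relation.Nullary using (¬_; yes; no)

≡ᵇ-refl : ∀ n → (n ≡ᵇ n) ≡ true
≡ᵇ-refl zero = refl
≡ᵇ-refl (suc n) = ≡ᵇ-refl n

≢⇒≡ᵇ≡false : ∀ m n → m ≢ n → (m ≡ᵇ n) ≡ false
≢⇒≡ᵇ≡false m n m≢n with m ≡ᵇ n in eq
... | true = ⊥-elim (m≢n (≡ᵇ⇒≡ m n (subst T (sym eq) tt)))
... | false = refl

lookupTy-▸⁻ : ∀ Γ A j {S} → lookupTy (Γ ▸ A) j ≡ just S →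
              (j ≡ lenCtx Γ × A ≡ S) ⊎ lookupTy Γ j ≡ just S
lookupTy-▸⁻ Γ A j eq with j ≡ᵇ lenCtx Γ in b
... | true = inj₁ (≡ᵇ⇒≡ j (lenCtx Γ) (subst T (sym b) tt) , just-injective eq)
... | false = inj₂ eq

lookupTy-last : ∀ Γ A → lookupTy (Γ ▸ A) (lenCtx Γ) ≡ just A
lookupTy-last Γ A rewrite ≡ᵇ-refl (lenCtx Γ) = refl

lookupTy-▸-≢ : ∀ Γ A j → j ≢ lenCtx Γ → lookupTy (Γ ▸ A) j ≡ lookupTy Γ j
lookupTy-▸-≢ Γ A j j≢ rewrite ≢⇒≡ᵇ≡false j (lenCtx Γ) j≢ = refl

lookupTy⇒< : ∀ Γ j {S} → lookupTy Γ j ≡ just S → j < lenCtx Γ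
lookupTy⇒< ∅ j ()
lookupTy⇒< (Γ ▸ A) j eq with lookupTy-▸⁻ Γ A j eq
... | inj₁ (refl , _) = ≤-refl
... | inj₂ eq′ = m≤n⇒m≤1+n (lookupTy⇒< Γ j eq′)

lookupTy-weaken : ∀ Γ A j {S} → lookupTy Γ j ≡ just S → lookupTy (Γ ▸ A) j ≡ just S
lookupTy-weaken Γ A j eq = trans (lookupTy-▸-≢ Γ A j (<⇒≢ (lookupTy⇒< Γ j eq))) eq

lookupSub-,,⁻ : ∀ σ t j {e} → lookupSub (σ ,, t) j ≡ just e →
                (j ≡ lenSub σ × t ≡ e) ⊎ lookupSub σ j ≡ just e
lookupSub-,,⁻ σ t j eq with j ≡ᵇ lenSub σ in b
... | true = inj₁ (≡ᵇ⇒≡ j (lenSub σ) (subst T (sym b) tt) , just-injective eq)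
... | false = inj₂ eq

lookupSub-last : ∀ σ t → lookupSub (σ ,, t) (lenSub σ) ≡ just t
lookupSub-last σ t rewrite ≡ᵇ-refl (lenSub σ) = refl

lookupSub-,,-≢ : ∀ σ t j → j ≢ lenSub σ → lookupSub (σ ,, t) j ≡ lookupSub σ j
lookupSub-,,-≢ σ t j j≢ rewrite ≢⇒≡ᵇ≡false j (lenSub σ) j≢ = refl

lookupSub⇒< : ∀ σ j {e} → lookupSub σ j ≡ just e → j < lenSub σ
lookupSub⇒< ⟨⟩ j ()
lookupSub⇒< (σ ,, t) j eq with lookupSub-,,⁻ σ t j eq
... | inj₁ (refl , _) = ≤-refl
... | inj₂ eq′ = m≤n⇒m≤1+n (lookupSub⇒< σ j eq′)

lookupSub-weaken : ∀ σ t j {e} → lookupSub σ j ≡ just e → lookupSub (σ ,, t) j ≡ just e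
lookupSub-weaken σ t j eq = trans (lookupSub-,,-≢ σ t j (<⇒≢ (lookupSub⇒< σ j eq))) eq

<⇒lookupSub : ∀ σ j → j < lenSub σ → ∃ λ e → lookupSub σ j ≡ just e
<⇒lookupSub ⟨⟩ j ()
<⇒lookupSub (σ ,, t) j j< with j ≟ lenSub σ
... | yes refl = t , lookupSub-last σ t
... | no j≢ with <⇒lookupSub σ j (≤∧≢⇒< (≤-pred j<) j≢)
...   | e , eq = e , trans (lookupSub-,,-≢ σ t j j≢) eq

lookupSub⇒≡mkSub : ∀ σ m g → lenSub σ ≡ m → (∀ i → i < m → lookupSub σ i ≡ just (g i)) →
                   σ ≡ mkSub m g
lookupSub⇒≡mkSub ⟨⟩ _ g refl h = refl
lookupSub⇒≡mkSub (σ ,, t) _ g refl h =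
  cong₂ _,,_
    (lookupSub⇒≡mkSub σ _ g refl λ i i< →
      trans (sym (lookupSub-,,-≢ σ t i (<⇒≢ i<))) (h i (m<n⇒m<1+n i<)))
    (just-injective (trans (sym (lookupSub-last σ t)) (h (lenSub σ) ≤-refl)))

mkSub-cong : ∀ m g h → (∀ i → i < m → g i ≡ h i) → mkSub m g ≡ mkSub m h
mkSub-cong zero g h eq = refl
mkSub-cong (suc m) g h eq = cong₂ _,,_ (mkSub-cong m g h λ i i< → eq i (m<n⇒m<1+n i<)) (eq m ≤-refl)

var-[]tm : ∀ σ j → var j [ σ ]tm ≡ fromMaybe (var j) (lookupSub σ j)
var-[]tm σ j with lookupSub σ j
... | just t = refl
... | nothing = refl

lookupSub⇒var-[]tm : ∀ σ j {e} → lookupSub σ j ≡ just e → var j [ σ ]tm ≡ e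
lookupSub⇒var-[]tm σ j eq = trans (var-[]tm σ j) (cong (fromMaybe (var j)) eq)

var-[,,]tm : ∀ σ e j → j < lenSub σ → var j [ σ ,, e ]tm ≡ var j [ σ ]tm
var-[,,]tm σ e j j< = begin
  var j [ σ ,, e ]tm                          ≡⟨ var-[]tm (σ ,, e) j ⟩
  fromMaybe (var j) (lookupSub (σ ,, e) j)    ≡⟨ cong (fromMaybe (var j)) (lookupSub-,,-≢ σ e j (<⇒≢ j<)) ⟩
  fromMaybe (var j) (lookupSub σ j)           ≡⟨ var-[]tm σ j ⟨
  var j [ σ ]tm                               ∎
  where open ≡-Reasoning

arr-cong : ∀ {s s′ A A′ t t′} → s ≡ s′ → A ≡ A′ → t ≡ t′ → arr s A t ≡ arr s′ A′ t′
arr-cong refl refl refl = refl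

-- The largest free variable

maximum : List ℕ → ℕ
maximum = foldr _⊔_ 0

maximum-++ : ∀ xs ys → maximum (xs ++ ys) ≡ maximum xs ⊔ maximum ys
maximum-++ [] ys = refl
maximum-++ (x ∷ xs) ys rewrite maximum-++ xs ys = sym (⊔-assoc x (maximum xs) (maximum ys))

mfvTm : Tm → ℕ
mfvTm t = maximum (fvTm t)

mfvTy : Ty → ℕ
mfvTy A = maximum (fvTy A)

mfvSub : Sub → ℕ
mfvSub σ = maximum (fvSub σ)

mfv-var : ∀ i → mfvTm (var i) ≡ i
mfv-var i = ⊔-identityʳ i

mfv-,, : ∀ σ t → mfvSub (σ ,, t) ≡ mfvSub σ ⊔ mfvTm t
mfv-,, σ t = maximum-++ (fvSub σ) (fvTm t)

mfv-arr : ∀ s A t → mfvTy (arr s A t) ≡ mfvTm s ⊔ (mfvTy A ⊔ mfvTm t)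
mfv-arr s A t =
  trans (maximum-++ (fvTm s) (fvTy A ++ fvTm t)) (cong (mfvTm s ⊔_) (maximum-++ (fvTy A) (fvTm t)))

lookupSub⇒mfv≤ : ∀ σ j {e} → lookupSub σ j ≡ just e → mfvTm e ≤ mfvSub σ
lookupSub⇒mfv≤ ⟨⟩ j ()
lookupSub⇒mfv≤ (σ ,, t) j {e} eq rewrite mfv-,, σ t with lookupSub-,,⁻ σ t j eq
... | inj₁ (_ , refl) = m≤n⊔m (mfvSub σ) (mfvTm t)
... | inj₂ eq′ = ≤-trans (lookupSub⇒mfv≤ σ j eq′) (m≤m⊔n (mfvSub σ) (mfvTm t))

mfvSub-lub : ∀ σ {K} → (∀ j e → lookupSub σ j ≡ just e → mfvTm e ≤ K) → mfvSub σ ≤ K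
mfvSub-lub ⟨⟩ bound = z≤n
mfvSub-lub (σ ,, t) bound rewrite mfv-,, σ t =
  ⊔-lub (mfvSub-lub σ λ j e eq → bound j e (lookupSub-weaken σ t j eq))
        (bound (lenSub σ) t (lookupSub-last σ t))

mutual
  mfv-[]tm≤ : ∀ t σ → All (_< lenSub σ) (fvTm t) → mfvTm (t [ σ ]tm) ≤ mfvSub σ
  mfv-[]tm≤ (var i) σ (i< ∷ []) with <⇒lookupSub σ i i<
  ... | e , eq rewrite lookupSub⇒var-[]tm σ i eq = lookupSub⇒mfv≤ σ i eq
  mfv-[]tm≤ (coh Δ A τ) σ scoped = mfv-∘s≤ τ σ scoped

  mfv-∘s≤ : ∀ τ σ → All (_< lenSub σ) (fvSub τ) → mfvSub (τ ∘s σ) ≤ mfvSub σ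
  mfv-∘s≤ ⟨⟩ σ scoped = z≤n
  mfv-∘s≤ (τ ,, t) σ scoped rewrite mfv-,, (τ ∘s σ) (t [ σ ]tm) =
    ⊔-lub (mfv-∘s≤ τ σ (++⁻ˡ (fvSub τ) scoped)) (mfv-[]tm≤ t σ (++⁻ʳ (fvSub τ) scoped))

mfv-[]ty≤ : ∀ A σ → All (_< lenSub σ) (fvTy A) → mfvTy (A [ σ ]ty) ≤ mfvSub σ
mfv-[]ty≤ ⋆ σ scoped = z≤n
mfv-[]ty≤ (arr s A t) σ scoped rewrite mfv-arr (s [ σ ]tm) (A [ σ ]ty) (t [ σ ]tm) =
  ⊔-lub (mfv-[]tm≤ s σ (++⁻ˡ (fvTm s) scoped))
        (⊔-lub (mfv-[]ty≤ A σ (++⁻ˡ (fvTy A) rest)) (mfv-[]tm≤ t σ (++⁻ʳ (fvTy A) rest)))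
  where rest = ++⁻ʳ (fvTm s) scoped

mutual
  mfv-image≤mfv-[]tm : ∀ t σ {x e} → x ∈ fvTm t → lookupSub σ x ≡ just e →
                       mfvTm e ≤ mfvTm (t [ σ ]tm)
  mfv-image≤mfv-[]tm (var i) σ (here refl) eq rewrite lookupSub⇒var-[]tm σ i eq = ≤-refl
  mfv-image≤mfv-[]tm (coh Δ A τ) σ x∈ eq = mfv-image≤mfv-∘s τ σ x∈ eq

  mfv-image≤mfv-∘s : ∀ τ σ {x e} → x ∈ fvSub τ → lookupSub σ x ≡ just e →
                     mfvTm e ≤ mfvSub (τ ∘s σ)
  mfv-image≤mfv-∘s ⟨⟩ σ () eq
  mfv-image≤mfv-∘s (τ ,, t) σ x∈ eq rewrite mfv-,, (τ ∘s σ) (t [ σ ]tm) with ∈-++⁻ (fvSub τ) x∈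
  ... | inj₁ x∈τ = ≤-trans (mfv-image≤mfv-∘s τ σ x∈τ eq) (m≤m⊔n _ _)
  ... | inj₂ x∈t = ≤-trans (mfv-image≤mfv-[]tm t σ x∈t eq) (m≤n⊔m _ _)

mfv-image≤mfv-[]ty : ∀ A σ {x e} → x ∈ fvTy A → lookupSub σ x ≡ just e →
                     mfvTm e ≤ mfvTy (A [ σ ]ty)
mfv-image≤mfv-[]ty ⋆ σ () eq
mfv-image≤mfv-[]ty (arr s A t) σ x∈ eq rewrite mfv-arr (s [ σ ]tm) (A [ σ ]ty) (t [ σ ]tm)
  with ∈-++⁻ (fvTm s) x∈
... | inj₁ x∈s = ≤-trans (mfv-image≤mfv-[]tm s σ x∈s eq) (m≤m⊔n _ _)
... | inj₂ x∈At with ∈-++⁻ (fvTy A) x∈At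
...   | inj₁ x∈A = ≤-trans (mfv-image≤mfv-[]ty A σ x∈A eq) (≤-trans (m≤m⊔n _ (mfvTm (t [ σ ]tm))) (m≤n⊔m (mfvTm (s [ σ ]tm)) _))
...   | inj₂ x∈t = ≤-trans (mfv-image≤mfv-[]tm t σ x∈t eq) (≤-trans (m≤n⊔m (mfvTy (A [ σ ]ty)) _) (m≤n⊔m (mfvTm (s [ σ ]tm)) _))

Telescopic : Ctx → Set
Telescopic Γ = ∀ ℓ S → lookupTy Γ ℓ ≡ just S → mfvTy S ≤ ℓ

2*-suc : ∀ k → 2 * suc k ≡ suc (suc (2 * k))
2*-suc k = *-suc 2 k

⌊2*k/2⌋≡k : ∀ k → ⌊ 2 * k /2⌋ ≡ k
⌊2*k/2⌋≡k zero = refl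
⌊2*k/2⌋≡k (suc k) = trans (cong ⌊_/2⌋ (2*-suc k)) (cong suc (⌊2*k/2⌋≡k k))

⌊1+2*k/2⌋≡k : ∀ k → ⌊ suc (2 * k) /2⌋ ≡ k
⌊1+2*k/2⌋≡k zero = refl
⌊1+2*k/2⌋≡k (suc k) = trans (cong (λ j → ⌊ suc j /2⌋) (2*-suc k)) (cong suc (⌊1+2*k/2⌋≡k k))

2*⌊j/2⌋≤j : ∀ j → 2 * ⌊ j /2⌋ ≤ j
2*⌊j/2⌋≤j zero = z≤n
2*⌊j/2⌋≤j (suc zero) = z≤n
2*⌊j/2⌋≤j (suc (suc j)) rewrite 2*-suc ⌊ j /2⌋ = s≤s (s≤s (2*⌊j/2⌋≤j j))

⌊j/2⌋≡k⇒j≡2*k⊎1+2*k : ∀ j k → ⌊ j /2⌋ ≡ k → j ≡ 2 * k ⊎ j ≡ suc (2 * k)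
⌊j/2⌋≡k⇒j≡2*k⊎1+2*k zero _ refl = inj₁ refl
⌊j/2⌋≡k⇒j≡2*k⊎1+2*k (suc zero) _ refl = inj₂ refl
⌊j/2⌋≡k⇒j≡2*k⊎1+2*k (suc (suc j)) (suc k) eq rewrite 2*-suc k
  with ⌊j/2⌋≡k⇒j≡2*k⊎1+2*k j k (suc-injective eq)
... | inj₁ refl = inj₁ refl
... | inj₂ refl = inj₂ refl

lenCtx-Disc : ∀ k → lenCtx (Disc k) ≡ suc (2 * k)
lenCtx-Disc zero = refl
lenCtx-Disc (suc k) rewrite 2*-suc k | lenCtx-Disc k = refl

lookupTy-Disc : ∀ n j {S} → lookupTy (Disc n) j ≡ just S → (j < suc (2 * n)) × (S ≡ Sph ⌊ j /2⌋)
lookupTy-Disc zero j eq with lookupTy-▸⁻ ∅ ⋆ j eq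
... | inj₁ (refl , refl) = s≤s z≤n , refl
lookupTy-Disc (suc n) j eq rewrite 2*-suc n with lookupTy-▸⁻ (Disc n ▸ Sph n) (Sph (suc n)) j eq
... | inj₁ (refl , refl) rewrite lenCtx-Disc n = ≤-refl , cong (λ m → Sph (suc m)) (sym (⌊2*k/2⌋≡k n))
... | inj₂ eq′ with lookupTy-▸⁻ (Disc n) (Sph n) j eq′
...   | inj₁ (refl , refl) rewrite lenCtx-Disc n = m≤n⇒m≤1+n ≤-refl , cong Sph (sym (⌊1+2*k/2⌋≡k n))
...   | inj₂ eq″ with lookupTy-Disc n j eq″
...     | j< , refl = m≤n⇒m≤1+n (m≤n⇒m≤1+n j<) , refl

lookupTy-Disc-top : ∀ k → lookupTy (Disc k) (2 * k) ≡ just (Sph k)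
lookupTy-Disc-top zero = refl
lookupTy-Disc-top (suc k) =
  subst (λ i → lookupTy (Disc (suc k)) i ≡ just (Sph (suc k)))
        (trans (cong suc (lenCtx-Disc k)) (sym (2*-suc k)))
        (lookupTy-last (Disc k ▸ Sph k) (Sph (suc k)))

mfv-Sph≤ : ∀ m → mfvTy (Sph m) ≤ 2 * m
mfv-Sph≤ zero = z≤n
mfv-Sph≤ (suc m)
  rewrite mfv-arr (var (2 * m)) (Sph m) (var (suc (2 * m))) | mfv-var (2 * m) | mfv-var (suc (2 * m)) | 2*-suc m =
  m≤n⇒m≤1+n (⊔-lub (n≤1+n _) (⊔-lub (m≤n⇒m≤1+n (mfv-Sph≤ m)) ≤-refl))

Telescopic-Disc : ∀ n → Telescopic (Disc n)
Telescopic-Disc n ℓ S eq with lookupTy-Disc n ℓ eq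
... | _ , refl = ≤-trans (mfv-Sph≤ ⌊ ℓ /2⌋) (2*⌊j/2⌋≤j ℓ)

lenSub-discSub : ∀ A t → lenSub (discSub A t) ≡ suc (2 * dim A)
lenSub-discSub ⋆ t = refl
lenSub-discSub (arr s A s′) t rewrite lenSub-discSub A s | 2*-suc (dim A) = refl

lookupSub-discSub-top : ∀ A t → lookupSub (discSub A t) (2 * dim A) ≡ just t
lookupSub-discSub-top ⋆ t = refl
lookupSub-discSub-top (arr s A s′) t =
  subst (λ i → lookupSub (discSub A s ,, s′ ,, t) i ≡ just t)
        (trans (cong suc (lenSub-discSub A s)) (sym (2*-suc (dim A))))
        (lookupSub-last (discSub A s ,, s′) t)

lookupSub-discSub-src : ∀ A s s′ → lookupSub (discSub A s ,, s′) (2 * dim A) ≡ just s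
lookupSub-discSub-src A s s′ =
  trans (lookupSub-,,-≢ (discSub A s) s′ (2 * dim A) (<⇒≢ (≤-reflexive (sym (lenSub-discSub A s)))))
        (lookupSub-discSub-top A s)

lookupSub-discSub-tgt : ∀ A s s′ → lookupSub (discSub A s ,, s′) (suc (2 * dim A)) ≡ just s′
lookupSub-discSub-tgt A s s′ =
  subst (λ i → lookupSub (discSub A s ,, s′) i ≡ just s′) (lenSub-discSub A s) (lookupSub-last (discSub A s) s′)

Sph-[,,]ty : ∀ m σ e → 2 * m ≤ lenSub σ → Sph m [ σ ,, e ]ty ≡ Sph m [ σ ]ty
Sph-[,,]ty zero σ e _ = refl
Sph-[,,]ty (suc m) σ e 2m+2≤ rewrite 2*-suc m =
  arr-cong (var-[,,]tm σ e (2 * m) (≤-trans (n≤1+n _) 2m+2≤))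
           (Sph-[,,]ty m σ e (≤-trans (n≤1+n _) (≤-trans (n≤1+n _) 2m+2≤)))
           (var-[,,]tm σ e (suc (2 * m)) 2m+2≤)

mutual
  Sph-[discSub] : ∀ A s → Sph (dim A) [ discSub A s ]ty ≡ A
  Sph-[discSub] ⋆ s = refl
  Sph-[discSub] (arr r B r′) s =
    trans (Sph-[,,]ty (suc (dim B)) (discSub B r ,, r′) s
            (subst (2 * suc (dim B) ≤_) (sym (cong suc (lenSub-discSub B r))) (≤-reflexive (2*-suc (dim B)))))
          (Sph-suc-[discSub] B r r′)

  Sph-suc-[discSub] : ∀ B r r′ → Sph (suc (dim B)) [ discSub B r ,, r′ ]ty ≡ arr r B r′
  Sph-suc-[discSub] B r r′ =
    arr-cong (lookupSub⇒var-[]tm (discSub B r ,, r′) (2 * dim B) (lookupSub-discSub-src B r r′))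
             (trans (Sph-[,,]ty (dim B) (discSub B r) r′ (subst (2 * dim B ≤_) (sym (lenSub-discSub B r)) (n≤1+n _)))
                    (Sph-[discSub] B r))
             (lookupSub⇒var-[]tm (discSub B r ,, r′) (suc (2 * dim B)) (lookupSub-discSub-tgt B r r′))

mfv-discSub : ∀ C u → mfvSub (discSub C u) ≡ mfvTy C ⊔ mfvTm u
mfv-discSub ⋆ u = refl
mfv-discSub (arr s A s′) u = begin
  mfvSub (discSub A s ,, s′ ,, u)                  ≡⟨ mfv-,, (discSub A s ,, s′) u ⟩
  mfvSub (discSub A s ,, s′) ⊔ mfvTm u             ≡⟨ cong (_⊔ mfvTm u) (mfv-,, (discSub A s) s′) ⟩
  (mfvSub (discSub A s) ⊔ mfvTm s′) ⊔ mfvTm u      ≡⟨ cong (λ m → (m ⊔ mfvTm s′) ⊔ mfvTm u) (mfv-discSub A s) ⟩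
  ((mfvTy A ⊔ mfvTm s) ⊔ mfvTm s′) ⊔ mfvTm u       ≡⟨ cong (λ m → (m ⊔ mfvTm s′) ⊔ mfvTm u) (⊔-comm (mfvTy A) (mfvTm s)) ⟩
  ((mfvTm s ⊔ mfvTy A) ⊔ mfvTm s′) ⊔ mfvTm u       ≡⟨ cong (_⊔ mfvTm u) (⊔-assoc (mfvTm s) (mfvTy A) (mfvTm s′)) ⟩
  (mfvTm s ⊔ (mfvTy A ⊔ mfvTm s′)) ⊔ mfvTm u       ≡⟨ cong (_⊔ mfvTm u) (mfv-arr s A s′) ⟨
  mfvTy (arr s A s′) ⊔ mfvTm u                     ∎
  where open ≡-Reasoning

-- Pasting contexts

Ascending : ℕ → Ty → Set
Ascending b ⋆ = ⊤
Ascending b (arr (var a) A (var c)) = (a < c) × (c < b) × Ascending a A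
Ascending b (arr (var a) A (coh _ _ _)) = ⊥
Ascending b (arr (coh _ _ _) A t) = ⊥

Ascending-mono : ∀ {b b′} A → b ≤ b′ → Ascending b A → Ascending b′ A
Ascending-mono ⋆ _ _ = tt
Ascending-mono (arr (var a) A (var c)) b≤b′ (a<c , c<b , asc) = a<c , ≤-trans c<b b≤b′ , asc

record PastingInvariant (Γ : Ctx) : Set where
  field
    ascending : ∀ ℓ S → lookupTy Γ ℓ ≡ just S → Ascending ℓ S
    target-typed : ∀ ℓ z B y → lookupTy Γ ℓ ≡ just (arr (var z) B (var y)) → lookupTy Γ y ≡ just B

open PastingInvariant

PastingInvariant-D⁰ : PastingInvariant (∅ ▸ ⋆)
PastingInvariant-D⁰ .ascending ℓ S eq with lookupTy-▸⁻ ∅ ⋆ ℓ eq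
... | inj₁ (_ , refl) = tt
PastingInvariant-D⁰ .target-typed ℓ z B y eq with lookupTy-▸⁻ ∅ ⋆ ℓ eq
... | inj₁ (_ , ())

PastingInvariant-extend : ∀ {Γ x A} → lookupTy Γ x ≡ just A → PastingInvariant Γ →
                          PastingInvariant (Γ ▸ A ▸ arr (var x) A (var (lenCtx Γ)))
PastingInvariant-extend {Γ} {x} {A} x∶A inv = record { ascending = asc ; target-typed = tgt }
  where
  L = lenCtx Γ
  x<L : x < L
  x<L = lookupTy⇒< Γ x x∶A
  asc : ∀ ℓ S → lookupTy (Γ ▸ A ▸ arr (var x) A (var L)) ℓ ≡ just S → Ascending ℓ S
  asc ℓ S eq with lookupTy-▸⁻ (Γ ▸ A) _ ℓ eq
  ... | inj₁ (refl , refl) = x<L , ≤-refl , inv .ascending x A x∶A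
  ... | inj₂ eq′ with lookupTy-▸⁻ Γ A ℓ eq′
  ...   | inj₁ (refl , refl) = Ascending-mono A (<⇒≤ x<L) (inv .ascending x A x∶A)
  ...   | inj₂ eq″ = inv .ascending ℓ S eq″
  tgt : ∀ ℓ z B y → lookupTy (Γ ▸ A ▸ arr (var x) A (var L)) ℓ ≡ just (arr (var z) B (var y)) →
        lookupTy (Γ ▸ A ▸ arr (var x) A (var L)) y ≡ just B
  tgt ℓ z B y eq with lookupTy-▸⁻ (Γ ▸ A) _ ℓ eq
  ... | inj₁ (refl , refl) = lookupTy-weaken (Γ ▸ A) _ L (lookupTy-last Γ A)
  ... | inj₂ eq′ with lookupTy-▸⁻ Γ A ℓ eq′
  ...   | inj₁ (refl , refl) = lookupTy-weaken (Γ ▸ A) _ y (lookupTy-weaken Γ A y (inv .target-typed x z B y x∶A))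
  ...   | inj₂ eq″ = lookupTy-weaken (Γ ▸ A) _ y (lookupTy-weaken Γ A y (inv .target-typed ℓ z B y eq″))

⊢p⇒lookup×invariant : ∀ {Γ x A} → Γ ⊢p x ∶ A → (lookupTy Γ x ≡ just A) × PastingInvariant Γ
⊢p⇒lookup×invariant pss = refl , PastingInvariant-D⁰
⊢p⇒lookup×invariant (pse {Γ} {x} {A} d) with ⊢p⇒lookup×invariant d
... | x∶A , inv = lookupTy-last (Γ ▸ A) _ , PastingInvariant-extend x∶A inv
⊢p⇒lookup×invariant (psd {f = f} {x} {A} {y} d) with ⊢p⇒lookup×invariant d
... | f∶ , inv = inv .target-typed f x A y f∶ , inv

⊢p⇒lookup : ∀ {Γ x A} → Γ ⊢p x ∶ A → lookupTy Γ x ≡ just A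
⊢p⇒lookup d = proj₁ (⊢p⇒lookup×invariant d)

⊢p⇒invariant : ∀ {Γ x A} → Γ ⊢p x ∶ A → PastingInvariant Γ
⊢p⇒invariant d = proj₂ (⊢p⇒lookup×invariant d)

⊢p⇒≢∅ : ∀ {Γ x A} → Γ ⊢p x ∶ A → Γ ≢ ∅
⊢p⇒≢∅ d refl with ⊢p⇒lookup d
... | ()

Op⇒IsPasting : ∀ {Δ A} → Op Δ A → IsPasting Δ
Op⇒IsPasting (comp _ _ _ ps _ _) = ps
Op⇒IsPasting (equiv _ _ _ ps _ _) = ps

data PastingShape : Ctx → Set where
  shape-D⁰ : PastingShape (∅ ▸ ⋆)
  shape-extend : ∀ {Γ x A} → PastingShape Γ → lookupTy Γ x ≡ just A →
                 PastingShape (Γ ▸ A ▸ arr (var x) A (var (lenCtx Γ)))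

⊢p⇒shape : ∀ {Γ x A} → Γ ⊢p x ∶ A → PastingShape Γ
⊢p⇒shape pss = shape-D⁰
⊢p⇒shape (pse d) = shape-extend (⊢p⇒shape d) (⊢p⇒lookup d)
⊢p⇒shape (psd d) = ⊢p⇒shape d

lookupTy⇒dim≤dimCtx : ∀ Γ x {A} → lookupTy Γ x ≡ just A → dim A ≤ dimCtx Γ
lookupTy⇒dim≤dimCtx ∅ x ()
lookupTy⇒dim≤dimCtx (Γ ▸ B) x eq with lookupTy-▸⁻ Γ B x eq
... | inj₁ (_ , refl) = m≤n⊔m (dimCtx Γ) (dim B)
... | inj₂ eq′ = ≤-trans (lookupTy⇒dim≤dimCtx Γ x eq′) (m≤m⊔n (dimCtx Γ) (dim B))

dropLast-⊆ : ∀ {w} xs → w ∈ dropLast xs → w ∈ xs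
dropLast-⊆ (x ∷ y ∷ xs) (here p) = here p
dropLast-⊆ (x ∷ y ∷ xs) (there p) = there (dropLast-⊆ (y ∷ xs) p)

bd⇒< : ∀ {Γ} → PastingShape Γ → ∀ ε i w → w ∈ bd ε i Γ → w < lenCtx Γ
bd⇒< shape-D⁰ ε i w (here refl) = s≤s z≤n
bd⇒< (shape-extend {Γ} {x} {A} sh _) ε i w w∈ with dim A <ᵇ i | i <ᵇ dim A
... | true | _ with ∈-++⁻ (bd ε i Γ) w∈
...   | inj₁ w∈Γ = m≤n⇒m≤1+n (m≤n⇒m≤1+n (bd⇒< sh ε i w w∈Γ))
...   | inj₂ (here refl) = m≤n⇒m≤1+n ≤-refl
...   | inj₂ (there (here refl)) = ≤-refl
bd⇒< (shape-extend sh _) ε i w w∈ | false | true = m≤n⇒m≤1+n (m≤n⇒m≤1+n (bd⇒< sh ε i w w∈))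
bd⇒< (shape-extend sh _) false i w w∈ | false | false = m≤n⇒m≤1+n (m≤n⇒m≤1+n (bd⇒< sh false i w w∈))
bd⇒< (shape-extend {Γ} sh _) true i w w∈ | false | false with ∈-++⁻ (dropLast (bd true i Γ)) w∈
... | inj₁ w∈Γ = m≤n⇒m≤1+n (m≤n⇒m≤1+n (bd⇒< sh true i w (dropLast-⊆ _ w∈Γ)))
... | inj₂ (here refl) = m≤n⇒m≤1+n ≤-refl

-- The witness is the last variable of dimension i.
bd-target⊈source : ∀ {Γ} → PastingShape Γ → ∀ i → i < dimCtx Γ →
                   ∃ λ w → (w ∈ bd true i Γ) × ¬ (w ∈ bd false i Γ)
bd-target⊈source shape-D⁰ i ()
bd-target⊈source (shape-extend {Γ} {x} {A} sh x∶A) i i< with dim A <ᵇ i in dimA<ᵇi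
... | true with bd-target⊈source sh i i<dimΓ
  where
  dimA<i : dim A < i
  dimA<i = <ᵇ⇒< (dim A) i (subst T (sym dimA<ᵇi) tt)
  i<dimΓ : i < dimCtx Γ
  i<dimΓ with i <? dimCtx Γ
  ... | yes i<dimΓ = i<dimΓ
  ... | no i≮dimΓ = ⊥-elim (≤⇒≯ (⊔-lub (⊔-lub (≮⇒≥ i≮dimΓ) (<⇒≤ dimA<i)) dimA<i) i<)
...   | w , w∈tgt , w∉src = w , ∈-++⁺ˡ w∈tgt , w∉src′
  where
  w<L : w < lenCtx Γ
  w<L = bd⇒< sh true i w w∈tgt
  w∉src′ : ¬ (w ∈ bd false i Γ ++ (lenCtx Γ ∷ suc (lenCtx Γ) ∷ []))
  w∉src′ w∈ with ∈-++⁻ (bd false i Γ) w∈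
  ... | inj₁ w∈src = w∉src w∈src
  ... | inj₂ (here refl) = <-irrefl refl w<L
  ... | inj₂ (there (here refl)) = <-irrefl refl (m<n⇒m<1+n w<L)
bd-target⊈source (shape-extend {Γ} {x} {A} sh x∶A) i i< | false with i <ᵇ dim A in i<ᵇdimA
... | true = bd-target⊈source sh i (≤-trans (<ᵇ⇒< i (dim A) (subst T (sym i<ᵇdimA) tt)) (lookupTy⇒dim≤dimCtx Γ x x∶A))
... | false = lenCtx Γ , ∈-++⁺ʳ (dropLast (bd true i Γ)) (here refl) , λ L∈ → <-irrefl refl (bd⇒< sh false i _ L∈)

¬target⊆nonempty⊆source : ∀ {Γ} → PastingShape Γ → (X : List ℕ) → (∃ λ x → x ∈ X) →
                          (∀ {x} → x ∈ X → x ∈ bdry false Γ) → (∀ {x} → x ∈ bdry true Γ → x ∈ X) → ⊥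
¬target⊆nonempty⊆source {Γ} sh X (x , x∈X) X⊆src tgt⊆X with dimCtx Γ in dimΓ
... | zero with X⊆src x∈X
...   | ()
¬target⊆nonempty⊆source {Γ} sh X (x , x∈X) X⊆src tgt⊆X | suc i
  with bd-target⊈source sh i (subst (i <_) (sym dimΓ) ≤-refl)
... | w , w∈tgt , w∉src = w∉src (X⊆src (tgt⊆X w∈tgt))

⊢s⇒lenSub : ∀ {Γ σ Δ} → Γ ⊢s σ ∶ Δ → lenSub σ ≡ lenCtx Δ
⊢s⇒lenSub ⟨⟩-sub = refl
⊢s⇒lenSub (ext-sub ⊢σ _ _) = cong suc (⊢s⇒lenSub ⊢σ)

mutual
  ⊢⇒fv-scoped : ∀ {Δ t A} → Δ ⊢ t ∶ A → All (_< lenCtx Δ) (fvTm t)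
  ⊢⇒fv-scoped (var-tm eq) = lookupTy⇒< _ _ eq ∷ []
  ⊢⇒fv-scoped (coh-tm _ _ ⊢τ) = ⊢s⇒fv-scoped ⊢τ
  ⊢⇒fv-scoped (conv-tm ⊢t _) = ⊢⇒fv-scoped ⊢t

  ⊢s⇒fv-scoped : ∀ {Δ τ Δ′} → Δ ⊢s τ ∶ Δ′ → All (_< lenCtx Δ) (fvSub τ)
  ⊢s⇒fv-scoped ⟨⟩-sub = []
  ⊢s⇒fv-scoped (ext-sub ⊢τ _ ⊢t) = ++⁺ (⊢s⇒fv-scoped ⊢τ) (⊢⇒fv-scoped ⊢t)

⊢ty⇒fv-scoped : ∀ {Δ A} → Δ ⊢ty A → All (_< lenCtx Δ) (fvTy A)
⊢ty⇒fv-scoped ⋆-ty = []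
⊢ty⇒fv-scoped (arr-ty ⊢A ⊢s ⊢t) = ++⁺ (⊢⇒fv-scoped ⊢s) (++⁺ (⊢ty⇒fv-scoped ⊢A) (⊢⇒fv-scoped ⊢t))

scoped-in : ∀ {Γ σ Δ xs} → Γ ⊢s σ ∶ Δ → All (_< lenCtx Δ) xs → All (_< lenSub σ) xs
scoped-in ⊢σ = subst (λ m → All (_< m) _) (sym (⊢s⇒lenSub ⊢σ))

mutual
  ⊢⇒fv-nonempty : ∀ {Γ t A} → Γ ⊢ t ∶ A → ∃ λ x → x ∈ fvTm t
  ⊢⇒fv-nonempty (var-tm {i = i} _) = i , here refl
  ⊢⇒fv-nonempty (coh-tm op _ ⊢τ) = ⊢s⇒fv-nonempty ⊢τ (⊢p⇒≢∅ (proj₂ (Op⇒IsPasting op)))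
  ⊢⇒fv-nonempty (conv-tm ⊢t _) = ⊢⇒fv-nonempty ⊢t

  ⊢s⇒fv-nonempty : ∀ {Γ τ Δ} → Γ ⊢s τ ∶ Δ → Δ ≢ ∅ → ∃ λ x → x ∈ fvSub τ
  ⊢s⇒fv-nonempty ⟨⟩-sub Δ≢∅ = ⊥-elim (Δ≢∅ refl)
  ⊢s⇒fv-nonempty (ext-sub {σ = σ} _ _ ⊢t) _ with ⊢⇒fv-nonempty ⊢t
  ... | x , x∈ = x , ∈-++⁺ʳ (fvSub σ) x∈

<⇒∈allVars : ∀ Δ j → j < lenCtx Δ → j ∈ allVars Δ
<⇒∈allVars (Δ ▸ A) j j< with j ≟ lenCtx Δ
... | yes refl = ∈-++⁺ʳ (allVars Δ) (here refl)
... | no j≢ = ∈-++⁺ˡ (<⇒∈allVars Δ j (≤∧≢⇒< (≤-pred j<) j≢))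

mfv-pruneSub-,, : ∀ p σ t → mfvSub (pruneSub p σ) ≤ mfvSub (pruneSub p (σ ,, t))
mfv-pruneSub-,, p σ t with (lenSub σ ≡ᵇ p) ∨ (lenSub σ ≡ᵇ suc p)
... | true = ≤-refl
... | false rewrite mfv-,, (pruneSub p σ) t = m≤m⊔n _ _

mfv-pruneSub≤ : ∀ p σ → mfvSub (pruneSub p σ) ≤ mfvSub σ
mfv-pruneSub≤ p ⟨⟩ = z≤n
mfv-pruneSub≤ p (σ ,, t) rewrite mfv-,, σ t with (lenSub σ ≡ᵇ p) ∨ (lenSub σ ≡ᵇ suc p)
... | true = ≤-trans (mfv-pruneSub≤ p σ) (m≤m⊔n _ _)
... | false rewrite mfv-,, (pruneSub p σ) t = ⊔-monoˡ-≤ (mfvTm t) (mfv-pruneSub≤ p σ)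

mfv-kept≤mfv-pruneSub : ∀ p σ j {e} → lookupSub σ j ≡ just e → j ≢ p → j ≢ suc p →
                        mfvTm e ≤ mfvSub (pruneSub p σ)
mfv-kept≤mfv-pruneSub p ⟨⟩ j ()
mfv-kept≤mfv-pruneSub p (σ ,, t) j {e} eq j≢p j≢sp with lookupSub-,,⁻ σ t j eq
... | inj₂ eq′ = ≤-trans (mfv-kept≤mfv-pruneSub p σ j eq′ j≢p j≢sp) (mfv-pruneSub-,, p σ t)
... | inj₁ (refl , refl)
  rewrite ≢⇒≡ᵇ≡false (lenSub σ) p j≢p | ≢⇒≡ᵇ≡false (lenSub σ) (suc p) j≢sp | mfv-,, (pruneSub p σ) e =
  m≤n⊔m _ _

-- Invariance of the largest free variable under definitional equality

-- An endo-coherence is never a composite (its source would contain its target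
-- boundary), and an invertible coherence mentions every variable of Δ in its
-- source or its type.
mfv-ecr : ∀ {Γ Δ s A σ S} → Γ ⊢ coh Δ (arr s A s) σ ∶ S → mfvSub σ ≡ mfvTm (idTm (A [ σ ]ty) (s [ σ ]tm))
mfv-ecr (conv-tm ⊢c _) = mfv-ecr ⊢c
mfv-ecr {s = s} {A} (coh-tm (comp _ _ _ (_ , ps) (s⊆src , _) (_ , tgt⊆s)) (arr-ty _ ⊢s _) _)
  with ⊢⇒fv-nonempty ⊢s
... | x , x∈s = ⊥-elim (¬target⊆nonempty⊆source (⊢p⇒shape ps) (fvTm s ++ fvTy A) (x , ∈-++⁺ˡ x∈s) s⊆src tgt⊆s)
mfv-ecr {Δ = Δ} {s} {A} {σ} (coh-tm (equiv _ _ _ _ (_ , Δ⊆sA) _) (arr-ty ⊢A ⊢s _) ⊢σ) =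
  trans (≤-antisym σ≤ ≤σ) (sym (mfv-discSub (A [ σ ]ty) (s [ σ ]tm)))
  where
  σ≤ : mfvSub σ ≤ mfvTy (A [ σ ]ty) ⊔ mfvTm (s [ σ ]tm)
  σ≤ = mfvSub-lub σ λ j e σj →
    [ (λ j∈s → ≤-trans (mfv-image≤mfv-[]tm s σ j∈s σj) (m≤n⊔m _ _)) ,
      (λ j∈A → ≤-trans (mfv-image≤mfv-[]ty A σ j∈A σj) (m≤m⊔n _ _)) ]
    (∈-++⁻ (fvTm s) (Δ⊆sA (<⇒∈allVars Δ j (subst (j <_) (⊢s⇒lenSub ⊢σ) (lookupSub⇒< σ j σj)))))
  ≤σ : mfvTy (A [ σ ]ty) ⊔ mfvTm (s [ σ ]tm) ≤ mfvSub σ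
  ≤σ = ⊔-lub (mfv-[]ty≤ A σ (scoped-in ⊢σ (⊢ty⇒fv-scoped ⊢A))) (mfv-[]tm≤ s σ (scoped-in ⊢σ (⊢⇒fv-scoped ⊢s)))

EndoAt : Tm → Ty → Set
EndoAt u ⋆ = ⊥
EndoAt u (arr a D b) = (mfvTm a ≡ mfvTm u) × (mfvTm b ≡ mfvTm u)

record IdentityEntryBounds (σ : Sub) (z y : ℕ) (C : Ty) (u : Tm) : Set where
  field
    src tgt : Tm
    lookup-src : lookupSub σ z ≡ just src
    lookup-tgt : lookupSub σ y ≡ just tgt
    mfv-src : mfvTm src ≡ mfvTm u
    mfv-tgt : mfvTm tgt ≡ mfvTm u
    mfv-C≤ : mfvTy C ≤ mfvTm u

IdentityEntryBounds-weaken : ∀ {σ z y C u} t → IdentityEntryBounds σ z y C u →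
                             IdentityEntryBounds (σ ,, t) z y C u
IdentityEntryBounds-weaken {σ} {z} {y} t b = record
  { src = src ; tgt = tgt
  ; lookup-src = lookupSub-weaken σ t z lookup-src
  ; lookup-tgt = lookupSub-weaken σ t y lookup-tgt
  ; mfv-src = mfv-src ; mfv-tgt = mfv-tgt ; mfv-C≤ = mfv-C≤
  }
  where open IdentityEntryBounds b

mutual
  mfv-type≤mfv-term : ∀ {Γ t A} → Telescopic Γ → Γ ⊢ t ∶ A → mfvTy A ≤ mfvTm t
  mfv-type≤mfv-term tel (var-tm {i = i} eq) = subst (_ ≤_) (sym (mfv-var i)) (tel _ _ eq)
  mfv-type≤mfv-term tel (coh-tm {A = A} {σ = σ} _ ⊢A ⊢σ) = mfv-[]ty≤ A σ (scoped-in ⊢σ (⊢ty⇒fv-scoped ⊢A))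
  mfv-type≤mfv-term tel (conv-tm ⊢t A＝B) = subst (_≤ _) (mfv-＝ty tel A＝B) (mfv-type≤mfv-term tel ⊢t)

  mfv-＝ : ∀ {Γ s t} → Telescopic Γ → Γ ⊢ s ＝ t → mfvTm s ≡ mfvTm t
  mfv-＝ tel (var-eq _) = refl
  mfv-＝ tel (sym-eq s＝t) = sym (mfv-＝ tel s＝t)
  mfv-＝ tel (trans-eq s＝t t＝u) = trans (mfv-＝ tel s＝t) (mfv-＝ tel t＝u)
  mfv-＝ tel (coh-eq _ σ＝τ) = mfv-＝s tel σ＝τ
  mfv-＝ tel (rule-eq (dr _ _) ⊢c) = mfv-dr tel ⊢c
  mfv-＝ tel (rule-eq (ecr _ _ _ _) ⊢c) = mfv-ecr ⊢c
  mfv-＝ tel (rule-eq (prune _ _ _ _ _ _ _ _ p+1∶ _ σp+1) ⊢c) = mfv-prune tel ⊢c p+1∶ σp+1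

  mfv-＝ty : ∀ {Γ A B} → Telescopic Γ → Γ ⊢ A ＝ty B → mfvTy A ≡ mfvTy B
  mfv-＝ty tel ⋆-eq = refl
  mfv-＝ty tel (arr-eq {s = s} {s′} {A} {A′} {t} {t′} s＝s′ A＝A′ t＝t′) = begin
    mfvTy (arr s A t)                    ≡⟨ mfv-arr s A t ⟩
    mfvTm s ⊔ (mfvTy A ⊔ mfvTm t)        ≡⟨ cong₂ _⊔_ (mfv-＝ tel s＝s′) (cong₂ _⊔_ (mfv-＝ty tel A＝A′) (mfv-＝ tel t＝t′)) ⟩
    mfvTm s′ ⊔ (mfvTy A′ ⊔ mfvTm t′)     ≡⟨ mfv-arr s′ A′ t′ ⟨
    mfvTy (arr s′ A′ t′)                 ∎
    where open ≡-Reasoning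

  mfv-＝s : ∀ {Γ σ τ} → Telescopic Γ → Γ ⊢ σ ＝s τ → mfvSub σ ≡ mfvSub τ
  mfv-＝s tel ⟨⟩-eq = refl
  mfv-＝s tel (ext-eq {σ = σ} {τ} {s} {t} σ＝τ s＝t) =
    trans (mfv-,, σ s) (trans (cong₂ _⊔_ (mfv-＝s tel σ＝τ) (mfv-＝ tel s＝t)) (sym (mfv-,, τ t)))

  mfv-disc-type≤ : ∀ {Γ C u} → Telescopic Γ → Γ ⊢s discSub C u ∶ Disc (dim C) → mfvTy C ≤ mfvTm u
  mfv-disc-type≤ {C = ⋆} _ _ = z≤n
  mfv-disc-type≤ {C = arr s A s′} {u} tel (ext-sub _ _ ⊢u) =
    subst (_≤ mfvTm u) (cong mfvTy (Sph-suc-[discSub] A s s′)) (mfv-type≤mfv-term tel ⊢u)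

  mfv-dr : ∀ {Γ A t S} → Telescopic Γ → Γ ⊢ coh (Disc (dim A)) (Sph (dim A)) (discSub A t) ∶ S →
           mfvSub (discSub A t) ≡ mfvTm t
  mfv-dr tel (conv-tm ⊢c _) = mfv-dr tel ⊢c
  mfv-dr {A = A} {t} tel (coh-tm _ _ ⊢σ) = trans (mfv-discSub A t) (m≤n⇒m⊔n≡n (mfv-disc-type≤ tel ⊢σ))

  EndoAt-＝ty : ∀ {Γ u S S′} → Telescopic Γ → Γ ⊢ S ＝ty S′ → EndoAt u S → EndoAt u S′
  EndoAt-＝ty tel (arr-eq a＝a′ _ b＝b′) (a≡u , b≡u) = trans (sym (mfv-＝ tel a＝a′)) a≡u , trans (sym (mfv-＝ tel b＝b′)) b≡u

  idTm-type : ∀ {Γ C u S} → Telescopic Γ → Γ ⊢ idTm C u ∶ S → EndoAt u S × (mfvTy C ≤ mfvTm u)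
  idTm-type tel (conv-tm ⊢id S＝S′) = let (endo , C≤) = idTm-type tel ⊢id in EndoAt-＝ty tel S＝S′ endo , C≤
  idTm-type {C = C} {u} tel (coh-tm _ _ ⊢σ) = (u≡ , u≡) , mfv-disc-type≤ tel ⊢σ
    where u≡ = cong mfvTm (lookupSub⇒var-[]tm (discSub C u) (2 * dim C) (lookupSub-discSub-top C u))

  identity-entry-bounds : ∀ {Γ σ Δ ℓ z B y C u} → Telescopic Γ → Γ ⊢s σ ∶ Δ →
                          lookupTy Δ ℓ ≡ just (arr (var z) B (var y)) → lookupSub σ ℓ ≡ just (idTm C u) →
                          z < ℓ → y < ℓ → IdentityEntryBounds σ z y C u
  identity-entry-bounds tel ⟨⟩-sub () _ _ _
  identity-entry-bounds {Δ = Δ ▸ A} {ℓ} {z} {B} {y} tel (ext-sub {σ = σ} {t = t} ⊢σ _ ⊢t) ℓ∶ σℓ z<ℓ y<ℓ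
    with lookupTy-▸⁻ Δ A ℓ ℓ∶ | lookupSub-,,⁻ σ t ℓ σℓ
  ... | inj₁ (refl , refl) | inj₂ σℓ′ = ⊥-elim (<-irrefl (sym (⊢s⇒lenSub ⊢σ)) (lookupSub⇒< σ _ σℓ′))
  ... | inj₂ ℓ∶′ | inj₁ (refl , _) = ⊥-elim (<-irrefl (⊢s⇒lenSub ⊢σ) (lookupTy⇒< Δ _ ℓ∶′))
  ... | inj₂ ℓ∶′ | inj₂ σℓ′ = IdentityEntryBounds-weaken t (identity-entry-bounds tel ⊢σ ℓ∶′ σℓ′ z<ℓ y<ℓ)
  ... | inj₁ (refl , refl) | inj₁ (_ , refl) =
    let ((z≡u , y≡u) , C≤) = idTm-type tel ⊢t
        (src , σz) = <⇒lookupSub σ z (subst (z <_) (sym (⊢s⇒lenSub ⊢σ)) z<ℓ)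
        (tgt , σy) = <⇒lookupSub σ y (subst (y <_) (sym (⊢s⇒lenSub ⊢σ)) y<ℓ)
    in record
      { src = src ; tgt = tgt
      ; lookup-src = lookupSub-weaken σ t z σz
      ; lookup-tgt = lookupSub-weaken σ t y σy
      ; mfv-src = trans (cong mfvTm (sym (lookupSub⇒var-[]tm σ z σz))) z≡u
      ; mfv-tgt = trans (cong mfvTm (sym (lookupSub⇒var-[]tm σ y σy))) y≡u
      ; mfv-C≤ = C≤
      }

  -- Pruning drops σ(p) and σ(p+1) = id(C, u); both are bounded by u, whose
  -- largest variable is that of the kept entry σ(z).
  mfv-prune : ∀ {Γ Δ A σ S p z B C u} → Telescopic Γ → Γ ⊢ coh Δ A σ ∶ S →
              lookupTy Δ (suc p) ≡ just (arr (var z) B (var p)) → lookupSub σ (suc p) ≡ just (idTm C u) →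
              mfvSub σ ≡ mfvSub (pruneSub p σ)
  mfv-prune tel (conv-tm ⊢c _) p+1∶ σp+1 = mfv-prune tel ⊢c p+1∶ σp+1
  mfv-prune {σ = σ} {p = p} {z} {C = C} {u} tel (coh-tm op _ ⊢σ) p+1∶ σp+1 =
    ≤-antisym (mfvSub-lub σ bound) (mfv-pruneSub≤ p σ)
    where
    z<p : z < p
    z<p = proj₁ (⊢p⇒invariant (proj₂ (Op⇒IsPasting op)) .ascending (suc p) _ p+1∶)
    open IdentityEntryBounds (identity-entry-bounds tel ⊢σ p+1∶ σp+1 (m<n⇒m<1+n z<p) ≤-refl)
    u≤ : mfvTm u ≤ mfvSub (pruneSub p σ)
    u≤ = subst (_≤ _) mfv-src (mfv-kept≤mfv-pruneSub p σ z lookup-src (<⇒≢ z<p) (<⇒≢ (m<n⇒m<1+n z<p)))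
    bound : ∀ j e → lookupSub σ j ≡ just e → mfvTm e ≤ mfvSub (pruneSub p σ)
    bound j e σj with j ≟ p | j ≟ suc p
    ... | yes refl | _ with trans (sym σj) lookup-tgt
    ...   | refl = subst (_≤ _) (sym mfv-tgt) u≤
    bound j e σj | no _ | yes refl with trans (sym σj) σp+1
    ...   | refl = subst (_≤ _) (sym (trans (mfv-discSub C u) (m≤n⇒m⊔n≡n mfv-C≤))) u≤
    bound j e σj | no j≢p | no j≢p+1 = mfv-kept≤mfv-pruneSub p σ j σj j≢p j≢p+1

-- Variable-to-variable substitutions into a disc

-- Only meaningful on types built from variables; other types are left alone.
renameTy : (ℕ → ℕ) → Ty → Ty
renameTy f ⋆ = ⋆
renameTy f (arr (var a) A (var c)) = arr (var (f a)) (renameTy f A) (var (f c))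
renameTy f (arr (var a) A (coh Δ B τ)) = arr (var a) A (coh Δ B τ)
renameTy f (arr (coh Δ B τ) A t) = arr (coh Δ B τ) A t

dim-renameTy : ∀ f A → dim (renameTy f A) ≡ dim A
dim-renameTy f ⋆ = refl
dim-renameTy f (arr (var a) A (var c)) = cong suc (dim-renameTy f A)
dim-renameTy f (arr (var a) A (coh Δ B τ)) = refl
dim-renameTy f (arr (coh Δ B τ) A t) = refl

dim-Sph : ∀ m → dim (Sph m) ≡ m
dim-Sph zero = refl
dim-Sph (suc m) = cong suc (dim-Sph m)

Sph≡arr⁻ : ∀ m {a B c} → Sph m ≡ arr (var a) B (var c) →
           Σ ℕ λ m′ → (m ≡ suc m′) × (a ≡ 2 * m′) × (B ≡ Sph m′) × (c ≡ suc (2 * m′))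
Sph≡arr⁻ (suc m) refl = m , refl , refl , refl , refl

Sph≡⋆⇒≡0 : ∀ m → Sph m ≡ ⋆ → m ≡ 0
Sph≡⋆⇒≡0 zero _ = refl

record TypedRenaming (n : ℕ) (Γ : Ctx) (f : ℕ → ℕ) : Set where
  constructor typed-renaming
  field
    lookup-renamed : ∀ ℓ S → lookupTy Γ ℓ ≡ just S → lookupTy (Disc n) (f ℓ) ≡ just (renameTy f S)

open TypedRenaming

TypedRenaming-▸⁻ : ∀ {n Γ A f} → TypedRenaming n (Γ ▸ A) f → TypedRenaming n Γ f
TypedRenaming-▸⁻ {Γ = Γ} {A} ren = typed-renaming λ ℓ S ℓ∶S → ren .lookup-renamed ℓ S (lookupTy-weaken Γ A ℓ ℓ∶S)

renameTy≡Sph : ∀ {n Γ f ℓ S} → TypedRenaming n Γ f → lookupTy Γ ℓ ≡ just S → renameTy f S ≡ Sph ⌊ f ℓ /2⌋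
renameTy≡Sph {n} {f = f} {ℓ} {S} ren ℓ∶S = proj₂ (lookupTy-Disc n (f ℓ) (ren .lookup-renamed ℓ S ℓ∶S))

renamed-source-even : ∀ {n Γ f ℓ a B c} → TypedRenaming n Γ f →
                      lookupTy Γ ℓ ≡ just (arr (var a) B (var c)) → ∃ λ m → f a ≡ 2 * m
renamed-source-even {f = f} {ℓ} ren ℓ∶ with Sph≡arr⁻ ⌊ f ℓ /2⌋ (sym (renameTy≡Sph ren ℓ∶))
... | m , _ , fa≡ , _ = m , fa≡

TypedRenaming-Disc : ∀ {n f} k → TypedRenaming n (Disc k) f →
                     (∀ i → i < 2 * k → f i ≡ i) × (⌊ f (2 * k) /2⌋ ≡ k)
TypedRenaming-Disc {f = f} zero ren = (λ i ()) , Sph≡⋆⇒≡0 ⌊ f 0 /2⌋ (sym (renameTy≡Sph ren refl))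
TypedRenaming-Disc {f = f} (suc k) ren
  with Sph≡arr⁻ _ (sym (renameTy≡Sph ren (lookupTy-Disc-top (suc k))))
... | m , top≡ , f2k≡ , Sphk≡ , f2k+1≡ = fixes , trans top≡ (cong suc (sym k≡m))
  where
  k≡m : k ≡ m
  k≡m = trans (sym (trans (dim-renameTy f (Sph k)) (dim-Sph k))) (trans (cong dim Sphk≡) (dim-Sph m))
  fixes : ∀ i → i < 2 * suc k → f i ≡ i
  fixes i i< with i ≟ 2 * k | i ≟ suc (2 * k)
  ... | yes refl | _ = trans f2k≡ (cong (2 *_) (sym k≡m))
  ... | no _ | yes refl = trans f2k+1≡ (cong (λ j → suc (2 * j)) (sym k≡m))
  ... | no i≢2k | no i≢2k+1 =
    proj₁ (TypedRenaming-Disc k (TypedRenaming-▸⁻ (TypedRenaming-▸⁻ ren))) i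
      (≤∧≢⇒< (≤-pred (≤∧≢⇒< (≤-pred (subst (i <_) (2*-suc k) i<)) i≢2k+1)) i≢2k)

data DiscPosition (k x : ℕ) (A : Ty) : Set where
  at-top : x ≡ 2 * k → A ≡ Sph k → DiscPosition k x A
  at-target : ∀ j → j < k → x ≡ suc (2 * j) → A ≡ Sph j → DiscPosition k x A

-- Gluing an arrow to d_j' would give a variable whose type has the odd source
-- d_j', which no sphere S^(m-1) of D^n has.
pasting-renaming⇒disc : ∀ {n f Γ x A} → TypedRenaming n Γ f → Γ ⊢p x ∶ A →
                        ∃ λ k → (Γ ≡ Disc k) × DiscPosition k x A
pasting-renaming⇒disc ren pss = 0 , refl , at-top refl refl
pasting-renaming⇒disc {f = f} ren (pse d)
  with pasting-renaming⇒disc (TypedRenaming-▸⁻ (TypedRenaming-▸⁻ ren)) d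
... | k , refl , at-top refl refl rewrite lenCtx-Disc k = suc k , refl , at-top (sym (2*-suc k)) refl
... | k , refl , at-target j j<k refl refl
  with renamed-source-even {ℓ = suc (lenCtx (Disc k))} ren (lookupTy-last (Disc k ▸ Sph j) (arr (var (suc (2 * j))) (Sph j) (var (lenCtx (Disc k)))))
...   | m , f2j+1≡2m = ⊥-elim (even≢odd m j (trans (sym f2j+1≡2m) f2j+1≡2j+1))
  where
  f2j+1≡2j+1 : f (suc (2 * j)) ≡ suc (2 * j)
  f2j+1≡2j+1 = proj₁ (TypedRenaming-Disc k (TypedRenaming-▸⁻ (TypedRenaming-▸⁻ ren))) (suc (2 * j))
                 (subst (_≤ 2 * k) (2*-suc j) (*-monoʳ-≤ 2 j<k))
pasting-renaming⇒disc ren (psd d) with pasting-renaming⇒disc ren d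
... | k , Γ≡ , at-top _ A≡ with Sph≡arr⁻ k (sym A≡)
...   | m , refl , _ , B≡ , y≡ = suc m , Γ≡ , at-target m ≤-refl y≡ B≡
pasting-renaming⇒disc ren (psd d) | k , Γ≡ , at-target j j<k _ A≡ with Sph≡arr⁻ j (sym A≡)
...   | m , refl , _ , B≡ , y≡ = k , Γ≡ , at-target m (<-trans (n<1+n m) j<k) y≡ B≡

VarTy : Ty → Set
VarTy ⋆ = ⊤
VarTy (arr (var a) A (var c)) = VarTy A
VarTy (arr (var a) A (coh _ _ _)) = ⊥
VarTy (arr (coh _ _ _) A t) = ⊥

VarTy-Sph : ∀ m → VarTy (Sph m)
VarTy-Sph zero = tt
VarTy-Sph (suc m) = VarTy-Sph m

Ascending⇒VarTy-renameTy : ∀ f b S → Ascending b S → VarTy (renameTy f S)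
Ascending⇒VarTy-renameTy f b ⋆ _ = tt
Ascending⇒VarTy-renameTy f b (arr (var a) A (var c)) (_ , _ , asc) = Ascending⇒VarTy-renameTy f a A asc

Ascending⇒[]ty≡renameTy : ∀ f ρ b S → Ascending b S → (∀ a → a < b → lookupSub ρ a ≡ just (var (f a))) →
                          S [ ρ ]ty ≡ renameTy f S
Ascending⇒[]ty≡renameTy f ρ b ⋆ _ _ = refl
Ascending⇒[]ty≡renameTy f ρ b (arr (var a) A (var c)) (a<c , c<b , asc) ρ≡f =
  arr-cong (lookupSub⇒var-[]tm ρ a (ρ≡f a a<b))
           (Ascending⇒[]ty≡renameTy f ρ a A asc λ a′ a′<a → ρ≡f a′ (<-trans a′<a a<b))
           (lookupSub⇒var-[]tm ρ c (ρ≡f c c<b))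
  where a<b = <-trans a<c c<b

MfvEq : Ty → Ty → Set
MfvEq ⋆ ⋆ = ⊤
MfvEq ⋆ (arr _ _ _) = ⊥
MfvEq (arr _ _ _) ⋆ = ⊥
MfvEq (arr s A t) (arr s′ A′ t′) = (mfvTm s ≡ mfvTm s′) × MfvEq A A′ × (mfvTm t ≡ mfvTm t′)

MfvEq-refl : ∀ A → MfvEq A A
MfvEq-refl ⋆ = tt
MfvEq-refl (arr s A t) = refl , MfvEq-refl A , refl

MfvEq-trans : ∀ A B C → MfvEq A B → MfvEq B C → MfvEq A C
MfvEq-trans ⋆ ⋆ ⋆ _ _ = tt
MfvEq-trans (arr _ A _) (arr _ B _) (arr _ C _) (s≡ , A≈B , t≡) (s≡′ , B≈C , t≡′) =
  trans s≡ s≡′ , MfvEq-trans A B C A≈B B≈C , trans t≡ t≡′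

＝ty⇒MfvEq : ∀ {Γ A B} → Telescopic Γ → Γ ⊢ A ＝ty B → MfvEq A B
＝ty⇒MfvEq tel ⋆-eq = tt
＝ty⇒MfvEq tel (arr-eq s＝s′ A＝A′ t＝t′) = mfv-＝ tel s＝s′ , ＝ty⇒MfvEq tel A＝A′ , mfv-＝ tel t＝t′

MfvEq⇒≡ : ∀ A B → VarTy A → VarTy B → MfvEq A B → A ≡ B
MfvEq⇒≡ ⋆ ⋆ _ _ _ = refl
MfvEq⇒≡ (arr (var a) A (var c)) (arr (var a′) B (var c′)) varA varB (a≡ , A≈B , c≡) =
  arr-cong (cong var (trans (sym (mfv-var a)) (trans a≡ (mfv-var a′))))
           (MfvEq⇒≡ A B varA varB A≈B)
           (cong var (trans (sym (mfv-var c)) (trans c≡ (mfv-var c′))))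

⊢var⇒lookup-MfvEq : ∀ {Γ j S} → Telescopic Γ → Γ ⊢ var j ∶ S →
                    Σ Ty λ S₀ → (lookupTy Γ j ≡ just S₀) × MfvEq S₀ S
⊢var⇒lookup-MfvEq tel (var-tm {A = A} j∶A) = A , j∶A , MfvEq-refl A
⊢var⇒lookup-MfvEq tel (conv-tm {A = A} {B} ⊢j A＝B) with ⊢var⇒lookup-MfvEq tel ⊢j
... | S₀ , j∶S₀ , S₀≈A = S₀ , j∶S₀ , MfvEq-trans S₀ A B S₀≈A (＝ty⇒MfvEq tel A＝B)

⊢var-Disc⇒lookup : ∀ {n j S} → Disc n ⊢ var j ∶ S → VarTy S → lookupTy (Disc n) j ≡ just S
⊢var-Disc⇒lookup {n} {j} ⊢j varS with ⊢var⇒lookup-MfvEq (Telescopic-Disc n) ⊢j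
... | S₀ , j∶S₀ , S₀≈S with lookupTy-Disc n j j∶S₀
...   | _ , refl = trans j∶S₀ (cong just (MfvEq⇒≡ _ _ (VarTy-Sph ⌊ j /2⌋) varS S₀≈S))

record TypedEntry (Γ : Ctx) (σ : Sub) (ℓ : ℕ) (S : Ty) : Set where
  field
    prefix : Sub
    entry : Tm
    lookup-entry : lookupSub σ ℓ ≡ just entry
    entry-typed : Γ ⊢ entry ∶ S [ prefix ]ty
    prefix-lookup : ∀ j {e} → lookupSub prefix j ≡ just e → lookupSub σ j ≡ just e
    prefix-length : lenSub prefix ≡ ℓ

lookup-⊢s : ∀ {Γ σ Δ ℓ S} → Γ ⊢s σ ∶ Δ → lookupTy Δ ℓ ≡ just S → TypedEntry Γ σ ℓ S
lookup-⊢s ⟨⟩-sub ()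
lookup-⊢s {ℓ = ℓ} (ext-sub {Δ = Δ} {σ = σ} {A = A} {t = t} ⊢σ _ ⊢t) ℓ∶S with lookupTy-▸⁻ Δ A ℓ ℓ∶S
... | inj₁ (refl , refl) = record
  { prefix = σ ; entry = t
  ; lookup-entry = subst (λ i → lookupSub (σ ,, t) i ≡ just t) (⊢s⇒lenSub ⊢σ) (lookupSub-last σ t)
  ; entry-typed = ⊢t
  ; prefix-lookup = λ j → lookupSub-weaken σ t j
  ; prefix-length = ⊢s⇒lenSub ⊢σ
  }
... | inj₂ ℓ∶S′ = record
  { prefix = prefix ; entry = entry
  ; lookup-entry = lookupSub-weaken σ t ℓ lookup-entry
  ; entry-typed = entry-typed
  ; prefix-lookup = λ j eq → lookupSub-weaken σ t j (prefix-lookup j eq)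
  ; prefix-length = prefix-length
  }
  where open TypedEntry (lookup-⊢s ⊢σ ℓ∶S′)

-- Junk value 0 off the variables; only used where σ is variable-to-variable.
renamingOf : Sub → ℕ → ℕ
renamingOf σ ℓ with lookupSub σ ℓ
... | just (var j) = j
... | _ = 0

renamingOf-lookup : ∀ σ {Γ} → VarToVar σ Γ → ∀ ℓ → ℓ < lenCtx Γ → lookupSub σ ℓ ≡ just (var (renamingOf σ ℓ))
renamingOf-lookup σ σ-var ℓ ℓ< with σ-var ℓ ℓ<
... | j , eq with lookupSub σ ℓ
...   | just (var j′) = refl

varToVar⇒typedRenaming : ∀ {n Γ σ x} → Γ ⊢p x ∶ ⋆ → Disc n ⊢s σ ∶ Γ → VarToVar σ Γ →
                         TypedRenaming n Γ (renamingOf σ)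
varToVar⇒typedRenaming {n} {Γ} {σ} ps ⊢σ σ-var = typed-renaming λ ℓ S ℓ∶S →
  let open TypedEntry (lookup-⊢s ⊢σ ℓ∶S)
      f = renamingOf σ
      ℓ< = lookupTy⇒< Γ ℓ ℓ∶S
      asc = ⊢p⇒invariant ps .ascending ℓ S ℓ∶S
      entry≡ : entry ≡ var (f ℓ)
      entry≡ = just-injective (trans (sym lookup-entry) (renamingOf-lookup σ σ-var ℓ ℓ<))
      prefix≡f : ∀ a → a < ℓ → lookupSub prefix a ≡ just (var (f a))
      prefix≡f a a< =
        let (e , eq) = <⇒lookupSub prefix a (subst (a <_) (sym prefix-length) a<)
        in trans eq (trans (sym (prefix-lookup a eq)) (renamingOf-lookup σ σ-var a (<-trans a< ℓ<)))
  in ⊢var-Disc⇒lookup (subst₂ (Disc n ⊢_∶_) entry≡ (Ascending⇒[]ty≡renameTy f prefix ℓ S asc prefix≡f) entry-typed)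
                      (Ascending⇒VarTy-renameTy f ℓ S asc)

subdiscIncl-by-top : ∀ n k t → t ≡ 2 * k ⊎ t ≡ suc (2 * k) → t < suc (2 * n) →
                     (k ≤ n) × SubdiscIncl n k (idSub (2 * k) ,, var t)
subdiscIncl-by-top n k _ (inj₁ refl) t< with m≤n⇒m<n∨m≡n (*-cancelˡ-≤ 2 (≤-pred t<))
... | inj₁ k<n = <⇒≤ k<n , src-incl k<n
... | inj₂ refl = ≤-refl , id-incl
subdiscIncl-by-top n k _ (inj₂ refl) t< = <⇒≤ k<n , tgt-incl k<n
  where k<n = *-cancelˡ-< 2 k n (≤-pred t<)

disc-renaming⇒subdiscIncl : ∀ {n k σ} → Disc n ⊢s σ ∶ Disc k → VarToVar σ (Disc k) →
                            TypedRenaming n (Disc k) (renamingOf σ) → (k ≤ n) × SubdiscIncl n k σ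
disc-renaming⇒subdiscIncl {n} {k} {σ} ⊢σ σ-var ren =
  subst (λ τ → (k ≤ n) × SubdiscIncl n k τ) (sym σ≡)
        (subdiscIncl-by-top n k (f (2 * k)) (⌊j/2⌋≡k⇒j≡2*k⊎1+2*k _ k top) top<)
  where
  f = renamingOf σ
  fixes : ∀ i → i < 2 * k → f i ≡ i
  fixes = proj₁ (TypedRenaming-Disc k ren)
  top : ⌊ f (2 * k) /2⌋ ≡ k
  top = proj₂ (TypedRenaming-Disc k ren)
  top< : f (2 * k) < suc (2 * n)
  top< = proj₁ (lookupTy-Disc n (f (2 * k)) (ren .lookup-renamed (2 * k) (Sph k) (lookupTy-Disc-top k)))
  σ≡ : σ ≡ idSub (2 * k) ,, var (f (2 * k))
  σ≡ = trans (lookupSub⇒≡mkSub σ (suc (2 * k)) (λ i → var (f i)) (trans (⊢s⇒lenSub ⊢σ) (lenCtx-Disc k))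
               λ i i< → renamingOf-lookup σ σ-var i (subst (i <_) (sym (lenCtx-Disc k)) i<))
             (cong (_,, var (f (2 * k))) (mkSub-cong (2 * k) (λ i → var (f i)) var λ i i< → cong var (fixes i i<)))

mainTheorem18 : (n : ℕ) (Γ : Ctx) (σ : Sub) →
    IsPasting Γ → Disc n ⊢s σ ∶ Γ → VarToVar σ Γ →
    Σ ℕ (λ k → (k ≤ n) × (Γ ≡ Disc k) × SubdiscIncl n k σ)
mainTheorem18 n Γ σ (_ , ps) ⊢σ σ-var
  with ren ← varToVar⇒typedRenaming {n} ps ⊢σ σ-var
  with pasting-renaming⇒disc ren ps
... | k , refl , _ =
  let (k≤n , incl) = disc-renaming⇒subdiscIncl ⊢σ σ-var ren
  in k , k≤n , refl , incl
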